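{- Let $r\ge1$ be an integer and let $C$ be the biaugmented Heaviside sequence of mass $T_{2r}+r$: $C_i=0$ for $i>T_{2r-1}+r$, and for $1\le i\le T_{2r-1}+r$, $C_i=3$ if $i=T_{2r-1}+1$, $C_i=2$ if $i=T_p+1$ for some $p\in\{1,\dots,2r-2\}$, and $C_i=1$ otherwise. Then the depth of $C$ is exactly $T_{2r}+2r(r-1)$.
   Context: $T_j=j(j+1)/2$. A mancala configuration is $\lambda:\mathbb N^*\to\mathbb N$ with support $\{1,\dots,\ell\}$ for some $\ell\ge0$. Move $\Phi$: $\mu=\Phi(\lambda)$, $\mu_i=\lambda_{i+1}+1$ for $1\le i\le\lambda_1$, $\mu_i=\lambda_{i+1}$ for $i>\lambda_1$; $\Phi^t$ its iterate. Componentwise order; $\lambda<\mu$ means $\lambda\le\mu$, $\lambda\ne\mu$. Marching group $M^j_i=j-i+1$ for $i\le j$, $0$ otherwise. Augmented marching group: mancala $\lambda$ with $M^j\le\lambda<M^{j+1}$ for some $j\ge0$. Depth of $\lambda$: least $t\ge0$ with $\Phi^t(\lambda)$ an augmented marching group. -}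

module Defs where

open import Data.Nat using (ℕ; zero; suc; _+_; _*_; _∸_; _≤_; _<_; _≡ᵇ_; _<ᵇ_; _/_)
open import Data.Bool using (Bool; true; false; if_then_else_; _∨_)
open import Data.List using (List; map; upTo)
open import Data.Bool.ListAction using (any)
open import Data.Product using (Σ; _×_; ∃-syntax)
open import Relation.Binary.PropositionalEquality using (_≡_)
open import Relation.Nullary using (¬_)

T : ℕ → ℕ
T zero = 0
T (suc j) = T j + suc j

-- A configuration λ : ℕ* → ℕ is represented as a function ℕ → ℕ with
-- shift by one: (λ i) stands for λ_{i+1}.
Config : Set
Config = ℕ → ℕ

IsMancala : Config → Set
IsMancala λc = ∃[ ℓ ] (∀ i → (i < ℓ → 1 ≤ λc i) × (ℓ ≤ i → λc i ≡ 0))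

-- The move Φ:  μ_i = λ_{i+1} + 1 for 1 ≤ i ≤ λ_1, μ_i = λ_{i+1} otherwise.
-- In 0-based shifted form: μ i = λ (i+1) + 1 if i < λ 0, else λ (i+1).
Φ : Config → Config
Φ λc i = if i <ᵇ λc 0 then suc (λc (suc i)) else λc (suc i)

Φ^ : ℕ → Config → Config
Φ^ zero λc = λc
Φ^ (suc t) λc = Φ (Φ^ t λc)

_≤ᶜ_ : Config → Config → Set
λc ≤ᶜ μ = ∀ i → λc i ≤ μ i

_<ᶜ_ : Config → Config → Set
λc <ᶜ μ = (λc ≤ᶜ μ) × ¬ (∀ i → λc i ≡ μ i)

-- Marching group M^j: M^j_p = j - p + 1 for p ≤ j, 0 otherwise (p = i+1).
M : ℕ → Config
M j i = j ∸ i

IsAugMarching : Config → Set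
IsAugMarching λc = IsMancala λc × ∃[ j ] ((M j ≤ᶜ λc) × (λc <ᶜ M (suc j)))

DepthIs : Config → ℕ → Set
DepthIs λc d = IsAugMarching (Φ^ d λc) × (∀ t → t < d → ¬ IsAugMarching (Φ^ t λc))

isTriPlusOne : ℕ → ℕ → Bool
isTriPlusOne r p = any (λ k → (T (suc k) + 1) ≡ᵇ p) (upTo (2 * r ∸ 2))
  -- k ranges over 0..2r-3, i.e. q = k+1 ranges over 1..2r-2

heavisideC : ℕ → Config
heavisideC r i =
  if (T (2 * r ∸ 1) + r) <ᵇ suc i then 0
  else if suc i ≡ᵇ (T (2 * r ∸ 1) + 1) then 3
  else if isTriPlusOne r (suc i) then 2
  else 1

-- Write head t for the first entry of Φ^t C. The t-th move sows one seed into each of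
-- the cells t+1, …, t + head t of C, so Φ^t C i is C (t+i) plus the number of earlier
-- moves whose sowing reaches cell t+i. Group the moves into blocks: first the 2r-1 blocks
-- [T k, T k + k] (k < 2r-1), then r blocks of length 2r starting at N = T(2r-1), the
-- index of the entry 3. If every sowing of a block reaches the end of the block, the heads
-- inside it are determined by C and by the sowings of the previous block alone; they turn
-- out constant on runs (a "stair" in the first phase, a "tent" in the second), and each
-- block's profile is computed from the previous one. After the last block, at time
-- T(2r-1) + r·2r = T(2r) + 2r(r-1), every entry equals M^{2r}_i or M^{2r+1}_i. Two moves
-- earlier the head drops from 2r+2 to 2r-1, which is impossible for an orbit that has
-- already passed an augmented marching group, because Φ preserves M^j ≤ λ ≤ M^{j+1}.

module Submission where

open import Defs
open import Data.Nat using (ℕ; zero; suc; _+_; _*_; _∸_; _≤_; _<_; z≤n; s≤s; z<s; _<ᵇ_; _≤ᵇ_; _≡ᵇ_; _≤?_; _<?_)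
open import Data.Nat.Properties
open import Data.Nat.Induction using (<-rec)
open import Data.Nat.Tactic.RingSolver using (solve; solve-∀)
open import Data.Bool using (Bool; true; false; if_then_else_) renaming (T to True)
open import Data.List using (List; []; _∷_)
open import Data.List.Membership.Propositional using (lose; find)
open import Data.List.Membership.Propositional.Properties using (∈-upTo⁺; ∈-upTo⁻)
open import Data.List.Relation.Unary.Any.Properties using (any⁺; any⁻)
open import Data.Unit using (⊤)
open import Data.Product using (_×_; _,_; proj₁; proj₂; ∃-syntax)
open import Data.Sum using (_⊎_; inj₁; inj₂) renaming (map to ⊎-map)
open import Function using (_∘_)
open import Relation.Nullary using (¬_; yes; no; contradiction)
open import Relation.Binary.PropositionalEquality

𝟙 : Bool → ℕ
𝟙 true  = 1
𝟙 false = 0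

𝟙-true : ∀ {b} → True b → 𝟙 b ≡ 1
𝟙-true {true} _ = refl

𝟙-false : ∀ {b} → ¬ True b → 𝟙 b ≡ 0
𝟙-false {true}  ¬b = contradiction _ ¬b
𝟙-false {false} _  = refl

if-true : ∀ {A : Set} {b} {x y : A} → True b → (if b then x else y) ≡ x
if-true {b = true} _ = refl

if-false : ∀ {A : Set} {b} {x y : A} → ¬ True b → (if b then x else y) ≡ y
if-false {b = true}  ¬b = contradiction _ ¬b
if-false {b = false} _  = refl

if-suc : ∀ b n → (if b then suc n else n) ≡ n + 𝟙 b
if-suc true  n = +-comm 1 n
if-suc false n = sym (+-identityʳ n)

+-cancelˡ-<ᵇ : ∀ t x y → (t + x <ᵇ t + y) ≡ (x <ᵇ y)
+-cancelˡ-<ᵇ zero    x y = refl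
+-cancelˡ-<ᵇ (suc t) x y = +-cancelˡ-<ᵇ t x y

<ᵇ-suc : ∀ x y → (x <ᵇ suc y) ≡ (x ≤ᵇ y)
<ᵇ-suc zero    y = refl
<ᵇ-suc (suc x) y = refl

+-cancelˡ-≤ᵇ : ∀ t x y → (t + x ≤ᵇ t + y) ≡ (x ≤ᵇ y)
+-cancelˡ-≤ᵇ zero    x y = refl
+-cancelˡ-≤ᵇ (suc t) x y = trans (<ᵇ-suc (t + x) (t + y)) (+-cancelˡ-≤ᵇ t x y)

∸-≡ : ∀ x y z → x ≡ y + z → x ∸ y ≡ z
∸-≡ x y z refl = m+n∸m≡n y z

∸-≡0 : ∀ x y e → y ≡ x + e → x ∸ y ≡ 0
∸-≡0 x y e refl = m≤n⇒m∸n≡0 (m≤m+n x e)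

count≥ : (ℕ → ℕ) → ℕ → ℕ → ℕ
count≥ g zero    x = 0
count≥ g (suc n) x = count≥ g n x + 𝟙 (x ≤ᵇ g n)

count≥-cong : ∀ {g h : ℕ → ℕ} n x → (∀ j → j < n → g j ≡ h j) → count≥ g n x ≡ count≥ h n x
count≥-cong zero    x g≡h = refl
count≥-cong (suc n) x g≡h =
  cong₂ _+_ (count≥-cong n x (λ j j<n → g≡h j (m<n⇒m<1+n j<n))) (cong (𝟙 ∘ (x ≤ᵇ_)) (g≡h n ≤-refl))

count≥-all : ∀ g n x → (∀ j → j < n → x ≤ g j) → count≥ g n x ≡ n
count≥-all g zero    x _   = refl
count≥-all g (suc n) x x≤g = begin
  count≥ g n x + 𝟙 (x ≤ᵇ g n) ≡⟨ cong₂ _+_ (count≥-all g n x (λ j j<n → x≤g j (m<n⇒m<1+n j<n)))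
                                           (𝟙-true (≤⇒≤ᵇ (x≤g n ≤-refl))) ⟩
  n + 1                       ≡⟨ +-comm n 1 ⟩
  suc n                       ∎
  where open ≡-Reasoning

count≥-split : ∀ g m n x → count≥ g (m + n) x ≡ count≥ g m x + count≥ (g ∘ (m +_)) n x
count≥-split g m zero    x = trans (cong (λ k → count≥ g k x) (+-identityʳ m)) (sym (+-identityʳ _))
count≥-split g m (suc n) x rewrite +-suc m n =
  trans (cong (_+ 𝟙 (x ≤ᵇ g (m + n))) (count≥-split g m n x)) (+-assoc (count≥ g m x) _ _)

count≥-shift : ∀ t g n x → count≥ (λ j → t + g j) n (t + x) ≡ count≥ g n x
count≥-shift t g zero    x = refl
count≥-shift t g (suc n) x = cong₂ _+_ (count≥-shift t g n x) (cong 𝟙 (+-cancelˡ-≤ᵇ t x (g n)))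

count≥-progression : ∀ K n x → count≥ (K +_) n x ≡ n ∸ (x ∸ K)
count≥-progression K zero    x = sym (0∸n≡0 (x ∸ K))
count≥-progression K (suc n) x with x ≤? K + n
... | yes x≤K+n = begin
  count≥ (K +_) n x + 𝟙 (x ≤ᵇ K + n) ≡⟨ cong₂ _+_ (count≥-progression K n x) (𝟙-true (≤⇒≤ᵇ x≤K+n)) ⟩
  n ∸ (x ∸ K) + 1                    ≡⟨ +-comm _ 1 ⟩
  1 + (n ∸ (x ∸ K))                  ≡⟨ +-∸-assoc 1 x∸K≤n ⟨
  suc n ∸ (x ∸ K)                    ∎
  where
  open ≡-Reasoning
  x∸K≤n : x ∸ K ≤ n
  x∸K≤n = subst (x ∸ K ≤_) (m+n∸m≡n K n) (∸-monoˡ-≤ K x≤K+n)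
... | no x≰K+n = begin
  count≥ (K +_) n x + 𝟙 (x ≤ᵇ K + n) ≡⟨ cong₂ _+_ (count≥-progression K n x) (𝟙-false (x≰K+n ∘ ≤ᵇ⇒≤ x (K + n))) ⟩
  n ∸ (x ∸ K) + 0                    ≡⟨ +-identityʳ _ ⟩
  n ∸ (x ∸ K)                        ≡⟨ m≤n⇒m∸n≡0 (<⇒≤ n<x∸K) ⟩
  0                                  ≡⟨ m≤n⇒m∸n≡0 n<x∸K ⟨
  suc n ∸ (x ∸ K)                    ∎
  where
  open ≡-Reasoning
  n<x∸K : suc n ≤ x ∸ K
  n<x∸K = subst (_≤ x ∸ K) (m+n∸m≡n K (suc n)) (∸-monoˡ-≤ K (subst (_≤ x) (sym (+-suc K n)) (≰⇒> x≰K+n)))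

-- Runs of equal heads

-- segment n K x is the number of j < n with x ≤ K + j. It is opaque so that the ring
-- solver never meets the truncated subtractions: segments are only ever evaluated through
-- segment-all, segment-none and segment-part, each given the slack as a witness.
opaque
  segment : ℕ → ℕ → ℕ → ℕ
  segment n K x = n ∸ (x ∸ K)

  count≥-segment : ∀ K n x → count≥ (K +_) n x ≡ segment n K x
  count≥-segment = count≥-progression

  segment-all : ∀ {n K x} e → K ≡ x + e → segment n K x ≡ n
  segment-all {n} {K} {x} e K≡x+e = cong (n ∸_) (m≤n⇒m∸n≡0 (subst (x ≤_) (sym K≡x+e) (m≤m+n x e)))

  segment-none : ∀ {n K x} e → x ≡ K + n + e → segment n K x ≡ 0
  segment-none {n} {K} e refl rewrite +-assoc K n e | m+n∸m≡n K (n + e) = m≤n⇒m∸n≡0 (m≤m+n n e)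

  segment-part : ∀ {n K x} w k → x ≡ K + w → n ≡ w + k → segment n K x ≡ k
  segment-part {K = K} w k refl refl rewrite m+n∸m≡n K w = m+n∸m≡n w k

record Run : Set where
  constructor run
  field
    len height : ℕ

open Run

span : List Run → ℕ
span []      = 0
span (ρ ∷ s) = len ρ + span s

Follows : (ℕ → ℕ) → ℕ → List Run → Set
Follows v off []            = ⊤
Follows v off (run n c ∷ s) = (∀ i → i < n → v (off + i) ≡ c) × Follows v (off + n) s

sowCount : ℕ → List Run → ℕ → ℕ
sowCount off []            y = 0
sowCount off (run n c ∷ s) y = segment n (off + c) y + sowCount (off + n) s y

singleton-run : ∀ (v : ℕ → ℕ) off c → v off ≡ c → ∀ i → i < 1 → v (off + i) ≡ c
singleton-run v off c v≡c zero    _            = trans (cong v (+-identityʳ off)) v≡c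
singleton-run v off c v≡c (suc i) (s≤s ())

singleton-run⁻ : ∀ (v : ℕ → ℕ) off c → (∀ i → i < 1 → v (off + i) ≡ c) → v off ≡ c
singleton-run⁻ v off c vᵢ≡c = trans (cong v (sym (+-identityʳ off))) (vᵢ≡c 0 z<s)

count≥-Follows : ∀ v off s y → Follows v off s →
  count≥ (λ j → (off + j) + v (off + j)) (span s) y ≡ sowCount off s y
count≥-Follows v off []            y _          = refl
count≥-Follows v off (run n c ∷ s) y (vᵢ≡c , f) = begin
  count≥ reach (n + span s) y
    ≡⟨ count≥-split reach n (span s) y ⟩
  count≥ reach n y + count≥ (reach ∘ (n +_)) (span s) y
    ≡⟨ cong₂ _+_ (count≥-cong n y onRun) (count≥-cong (span s) y (λ j _ → cong reach′ (sym (+-assoc off n j)))) ⟩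
  count≥ ((off + c) +_) n y + count≥ (λ j → (off + n + j) + v (off + n + j)) (span s) y
    ≡⟨ cong₂ _+_ (count≥-segment (off + c) n y) (count≥-Follows v (off + n) s y f) ⟩
  segment n (off + c) y + sowCount (off + n) s y
    ∎
  where
  open ≡-Reasoning
  reach′ : ℕ → ℕ
  reach′ j = j + v j
  reach : ℕ → ℕ
  reach j = reach′ (off + j)
  onRun : ∀ j → j < n → reach j ≡ off + c + j
  onRun j j<n rewrite vᵢ≡c j j<n = solve (off ∷ j ∷ c ∷ [])

HeightsAtLeast : ℕ → List Run → Set
HeightsAtLeast b []            = ⊤
HeightsAtLeast b (run n c ∷ s) = b ≤ c × HeightsAtLeast b s

Follows-≥ : ∀ {b} v off s → HeightsAtLeast b s → Follows v off s → ∀ u → u < span s → b ≤ v (off + u)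
Follows-≥ v off (run n c ∷ s) (b≤c , hs) (vᵢ≡c , f) u u<span with u <? n
... | yes u<n = subst (_ ≤_) (sym (vᵢ≡c u u<n)) b≤c
... | no u≮n with m≤n⇒∃[o]m+o≡n (≮⇒≥ u≮n)
...   | w , refl = subst (_ ≤_) (cong v (+-assoc off n w)) (Follows-≥ v (off + n) s hs f w (+-cancelˡ-< n w (span s) u<span))

-- Sowing

Φ-unfold : ∀ μ i → Φ μ i ≡ μ (suc i) + 𝟙 (i <ᵇ μ 0)
Φ-unfold μ i = if-suc (i <ᵇ μ 0) (μ (suc i))

module Sowing (λc : Config) where

  head : ℕ → ℕ
  head t = Φ^ t λc 0

  reach : ℕ → ℕ
  reach t = t + head t

  -- Index i of Φ^t λ is cell t + i of λ, and the s-th move adds one seed to the cells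
  -- s+1, …, reach s.
  Φ^-count : ∀ t i → Φ^ t λc i ≡ λc (t + i) + count≥ reach t (t + i)
  Φ^-count zero    i = sym (+-identityʳ _)
  Φ^-count (suc t) i = begin
    Φ (Φ^ t λc) i
      ≡⟨ Φ-unfold (Φ^ t λc) i ⟩
    Φ^ t λc (suc i) + 𝟙 (i <ᵇ head t)
      ≡⟨ cong₂ _+_ (Φ^-count t (suc i)) (cong 𝟙 (sym (+-cancelˡ-<ᵇ t i (head t)))) ⟩
    λc (t + suc i) + count≥ reach t (t + suc i) + 𝟙 (t + i <ᵇ reach t)
      ≡⟨ cong (λ k → λc k + count≥ reach t k + 𝟙 (t + i <ᵇ reach t)) (+-suc t i) ⟩
    λc (suc t + i) + count≥ reach t (suc t + i) + 𝟙 (suc t + i ≤ᵇ reach t)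
      ≡⟨ +-assoc (λc (suc t + i)) _ _ ⟩
    λc (suc t + i) + count≥ reach (suc t) (suc t + i)
      ∎
    where open ≡-Reasoning

  head-count : ∀ t → head t ≡ λc t + count≥ reach t t
  head-count t = trans (Φ^-count t 0) (cong (λ k → λc k + count≥ reach t k) (+-identityʳ t))

  Carry : ℕ → (ℕ → ℕ) → Set
  Carry B P = ∀ x → count≥ reach B (B + x) ≡ P x

  Carry-cong : ∀ B {P P′} → Carry B P → (∀ x → P x ≡ P′ x) → Carry B P′
  Carry-cong B carried P≡P′ x = trans (carried x) (P≡P′ x)

  blockHeads : ℕ → (ℕ → ℕ) → ℕ → ℕ
  blockHeads B P u = λc (B + u) + P u + u

  -- L consecutive moves from time B, with the seeds P sown into them before B, whose
  -- sowings all reach the last cell of the block: then the move B + u receives exactly one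
  -- seed from each of the u moves before it in the block.
  record Block (B : ℕ) (P : ℕ → ℕ) (s : List Run) (L : ℕ) : Set where
    field
      carried : Carry B P
      follows : Follows (blockHeads B P) 0 s
      spans   : span s ≡ L
      floor   : ℕ
      spanned : L ≤ suc floor
      tall    : HeightsAtLeast floor s

  module _ {B P s L} (blk : Block B P s L) where
    open Block blk
    private
      v : ℕ → ℕ
      v = blockHeads B P

    block-heads : ∀ u → u < L → head (B + u) ≡ v u
    block-heads = <-rec (λ u → u < L → head (B + u) ≡ v u) step
      where
      step : ∀ u → (∀ {j} → j < u → j < L → head (B + j) ≡ v j) → u < L → head (B + u) ≡ v u
      step u ih u<L = begin
        head (B + u)
          ≡⟨ head-count (B + u) ⟩
        λc (B + u) + count≥ reach (B + u) (B + u)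
          ≡⟨ cong (λc (B + u) +_) (count≥-split reach B u (B + u)) ⟩
        λc (B + u) + (count≥ reach B (B + u) + count≥ (reach ∘ (B +_)) u (B + u))
          ≡⟨ cong (λc (B + u) +_) (cong₂ _+_ (carried u) (count≥-all _ u (B + u) earlierReach)) ⟩
        λc (B + u) + (P u + u)
          ≡⟨ +-assoc (λc (B + u)) (P u) u ⟨
        v u
          ∎
        where
        open ≡-Reasoning
        earlierReach : ∀ j → j < u → B + u ≤ reach (B + j)
        earlierReach j j<u = subst (B + u ≤_) reach≡ (+-monoʳ-≤ B (≤-trans u≤vj (m≤n+m (v j) j)))
          where
          reach≡ : B + (j + v j) ≡ reach (B + j)
          reach≡ = trans (sym (+-assoc B j (v j))) (cong (B + j +_) (sym (ih j<u (<-trans j<u u<L))))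
          u≤vj : u ≤ v j
          u≤vj = ≤-pred (≤-trans u<L (≤-trans spanned (s≤s (Follows-≥ v 0 s tall follows j
                   (subst (j <_) (sym spans) (<-trans j<u u<L))))))

    block-carry : Carry (B + L) (λ x → P (L + x) + sowCount 0 s (L + x))
    block-carry x = begin
      count≥ reach (B + L) (B + L + x)
        ≡⟨ count≥-split reach B L (B + L + x) ⟩
      count≥ reach B (B + L + x) + count≥ (reach ∘ (B +_)) L (B + L + x)
        ≡⟨ cong₂ _+_ (cong (count≥ reach B) (+-assoc B L x)) (count≥-cong L _ reachInBlock) ⟩
      count≥ reach B (B + (L + x)) + count≥ (λ j → B + (j + v j)) L (B + L + x)
        ≡⟨ cong₂ _+_ (carried (L + x)) (cong (count≥ (λ j → B + (j + v j)) L) (+-assoc B L x)) ⟩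
      P (L + x) + count≥ (λ j → B + (j + v j)) L (B + (L + x))
        ≡⟨ cong (P (L + x) +_) (count≥-shift B (λ j → j + v j) L (L + x)) ⟩
      P (L + x) + count≥ (λ j → j + v j) L (L + x)
        ≡⟨ cong (P (L + x) +_) (subst (λ n → count≥ (λ j → j + v j) n (L + x) ≡ sowCount 0 s (L + x))
                                       spans (count≥-Follows v 0 s (L + x) follows)) ⟩
      P (L + x) + sowCount 0 s (L + x)
        ∎
      where
      open ≡-Reasoning
      reachInBlock : ∀ j → j < L → reach (B + j) ≡ B + (j + v j)
      reachInBlock j j<L = trans (cong (B + j +_) (block-heads j j<L)) (+-assoc B j (v j))

-- Sandwiches between consecutive marching groups

Sandwiched : ℕ → Config → Set
Sandwiched j λc = M j ≤ᶜ λc × λc ≤ᶜ M (suc j)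

augmented⇒sandwiched : ∀ {λc} → IsAugMarching λc → ∃[ j ] Sandwiched j λc
augmented⇒sandwiched (_ , j , low , high , _) = j , low , high

between-marching⇒sandwiched : ∀ {j λc} → (∀ i → λc i ≡ M j i ⊎ λc i ≡ M (suc j) i) → Sandwiched j λc
between-marching⇒sandwiched {j} {λc} between = low , high
  where
  low : M j ≤ᶜ λc
  low i with between i
  ... | inj₁ eq = ≤-reflexive (sym eq)
  ... | inj₂ eq = subst (M j i ≤_) (sym eq) (∸-monoˡ-≤ i (n≤1+n j))
  high : λc ≤ᶜ M (suc j)
  high i with between i
  ... | inj₁ eq = subst (_≤ M (suc j) i) (sym eq) (∸-monoˡ-≤ i (n≤1+n j))
  ... | inj₂ eq = ≤-reflexive eq

sandwiched⇒augmented : ∀ {j λc} → Sandwiched j λc → λc 0 ≢ suc j → IsAugMarching λc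
sandwiched⇒augmented {j} {λc} (low , high) λ₀≢1+j = mancala , j , low , high , λ λ≡M → λ₀≢1+j (λ≡M 0)
  where
  positive : ∀ i → i < j → 1 ≤ λc i
  positive i i<j = ≤-trans (m<n⇒0<n∸m i<j) (low i)
  vanishes : ∀ i → suc j ≤ i → λc i ≡ 0
  vanishes i 1+j≤i = n≤0⇒n≡0 (subst (λc i ≤_) (m≤n⇒m∸n≡0 1+j≤i) (high i))
  mancala : IsMancala λc
  mancala with λc j in λj
  ... | zero  = j , λ i → positive i , λ j≤i → case≤ i j≤i
    where
    case≤ : ∀ i → j ≤ i → λc i ≡ 0
    case≤ i j≤i with m≤n⇒m<n∨m≡n j≤i
    ... | inj₁ j<i  = vanishes i j<i
    ... | inj₂ refl = λj
  ... | suc _ = suc j , λ i → case< i , vanishes i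
    where
    case< : ∀ i → i < suc j → 1 ≤ λc i
    case< i i<1+j with m<1+n⇒m<n∨m≡n i<1+j
    ... | inj₁ i<j  = positive i i<j
    ... | inj₂ refl = subst (1 ≤_) (sym λj) (s≤s z≤n)

m∸n≤1+m∸[1+n] : ∀ m n → m ∸ n ≤ suc (m ∸ suc n)
m∸n≤1+m∸[1+n] zero    zero    = z≤n
m∸n≤1+m∸[1+n] zero    (suc n) = z≤n
m∸n≤1+m∸[1+n] (suc m) zero    = ≤-refl
m∸n≤1+m∸[1+n] (suc m) (suc n) = m∸n≤1+m∸[1+n] m n

Φ-sandwiched : ∀ {j} λc → Sandwiched j λc → Sandwiched j (Φ λc)
Φ-sandwiched {j} λc (low , high) = low′ , high′
  where
  low′ : M j ≤ᶜ Φ λc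
  low′ i with i <? λc 0
  ... | yes i<λ₀ = subst (j ∸ i ≤_) (sym (if-true (<⇒<ᵇ i<λ₀))) (≤-trans (m∸n≤1+m∸[1+n] j i) (s≤s (low (suc i))))
  ... | no  i≮λ₀ = subst (_≤ Φ λc i) (sym (m≤n⇒m∸n≡0 (≤-trans (low 0) (≮⇒≥ i≮λ₀)))) z≤n
  high′ : Φ λc ≤ᶜ M (suc j)
  high′ i with i <? λc 0
  ... | yes i<λ₀ = subst₂ _≤_ (sym (if-true (<⇒<ᵇ i<λ₀))) (sym (+-∸-assoc 1 (≤-pred (≤-trans i<λ₀ (high 0)))))
                          (s≤s (high (suc i)))
  ... | no  i≮λ₀ = subst (_≤ suc j ∸ i) (sym (if-false (i≮λ₀ ∘ <ᵇ⇒< i (λc 0))))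
                          (≤-trans (high (suc i)) (∸-monoˡ-≤ i (n≤1+n j)))

Φ^-sandwiched : ∀ {j λc t u} → t ≤ u → Sandwiched j (Φ^ t λc) → Sandwiched j (Φ^ u λc)
Φ^-sandwiched {u = zero}  z≤n    sw = sw
Φ^-sandwiched {u = suc u} t≤1+u sw with m≤n⇒m<n∨m≡n t≤1+u
... | inj₁ t<1+u = Φ-sandwiched _ (Φ^-sandwiched (≤-pred t<1+u) sw)
... | inj₂ refl  = sw

module _ (λc : Config) where
  open Sowing λc

  -- The sandwich M^j ≤ λ ≤ M^{j+1} persists under Φ and keeps the head in {j, j+1}, so
  -- the head cannot then drop by 2; right after such a drop, the seed sown at index
  -- head (d+1) + 1 violates the upper bound.
  not-augmented-before-drop : ∀ d → 2 + head (suc d) ≤ head d → ∀ t → t ≤ suc d → ¬ IsAugMarching (Φ^ t λc)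
  not-augmented-before-drop d drop t t≤1+d aug
    with j , sw ← augmented⇒sandwiched aug | m≤n⇒m<n∨m≡n t≤1+d
  ... | inj₁ t<1+d = <-irrefl refl (≤-trans drop (≤-trans headd≤1+j (s≤s j≤head1+d)))
    where
    headd≤1+j : head d ≤ suc j
    headd≤1+j = proj₂ (Φ^-sandwiched (≤-pred t<1+d) sw) 0
    j≤head1+d : j ≤ head (suc d)
    j≤head1+d = proj₁ (Φ^-sandwiched t≤1+d sw) 0
  ... | inj₂ refl = contradiction (n≤0⇒n≡0 (subst₂ _≤_ sown (m≤n⇒m∸n≡0 (proj₁ sw 0)) (proj₂ sw (suc h₁)))) λ ()
    where
    h₁ : ℕ
    h₁ = head (suc d)
    sown : Φ^ (suc d) λc (suc h₁) ≡ suc (Φ^ d λc (suc (suc h₁)))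
    sown = if-true (<⇒<ᵇ drop)

  depth-after-drop : ∀ d → 2 + head (suc d) ≤ head d → IsAugMarching (Φ^ (2 + d) λc) → DepthIs λc (2 + d)
  depth-after-drop d drop aug = aug , λ t t<2+d → not-augmented-before-drop d drop t (≤-pred t<2+d)

T-mono-≤ : ∀ {m n} → m ≤ n → T m ≤ T n
T-mono-≤ {n = zero}  z≤n   = z≤n
T-mono-≤ {m} {suc n} m≤1+n with m≤n⇒m<n∨m≡n m≤1+n
... | inj₁ m<1+n = ≤-trans (T-mono-≤ (≤-pred m<1+n)) (m≤m+n (T n) (suc n))
... | inj₂ refl  = ≤-refl

T-mono-< : ∀ {m n} → m < n → T m < T n
T-mono-< {m} m<n = <-≤-trans (m<m+n (T m) z<s) (T-mono-≤ m<n)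

T-gap : ∀ k u p → 1 ≤ u → u ≤ k → T p ≢ T k + u
T-gap k u p 1≤u u≤k Tp≡ with p ≤? k
... | yes p≤k = <⇒≱ (m<m+n (T k) 1≤u) (subst (_≤ T k) Tp≡ (T-mono-≤ p≤k))
... | no  p≰k = <⇒≢ (<-≤-trans (+-monoʳ-< (T k) (s≤s u≤k)) (T-mono-≤ (≰⇒> p≰k))) (sym Tp≡)

isTriPlusOne-true : ∀ r k → k < 2 * r ∸ 2 → True (isTriPlusOne r (suc (T (suc k))))
isTriPlusOne-true r k k<2r-2 = any⁺ _ (lose (∈-upTo⁺ k<2r-2) (≡⇒≡ᵇ _ _ (+-comm (T (suc k)) 1)))

isTriPlusOne-false : ∀ r i → (∀ k → k < 2 * r ∸ 2 → i ≢ T (suc k)) → ¬ True (isTriPlusOne r (suc i))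
isTriPlusOne-false r i notTri isTri with k , k∈ , Tk+1≡1+i ← find (any⁻ _ _ isTri) =
  notTri k (∈-upTo⁻ k∈) (suc-injective (trans (sym (≡ᵇ⇒≡ _ _ Tk+1≡1+i)) (+-comm (T (suc k)) 1)))

2*suc : ∀ q → 2 * suc q ≡ suc (suc (q + q))
2*suc = solve-∀

T-suc-pos : ∀ k → 0 < T (suc k)
T-suc-pos k = <-≤-trans z<s (m≤n+m (suc k) (T k))

-- Stair and tent blocks

stair : ℕ → List Run
stair k = run k (suc (suc k)) ∷ run 1 (suc k) ∷ []

-- Here the heads of a block are c u + (seeds from the previous block) + u. Each segment of
-- the previous block is evaluated by exhibiting its slack; ring normalisation does the rest.
infixr 5 _⟨+⟩_
_⟨+⟩_ : ∀ {a b c d} → a ≡ b → c ≡ d → a + c ≡ b + d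
_⟨+⟩_ = cong₂ _+_

heads≡ : ∀ {c c′ s s′ u t} → c ≡ c′ → s ≡ s′ → c′ + s′ + u ≡ t → c + s + u ≡ t
heads≡ refl refl eq = eq

stair-step : ∀ k (c : ℕ → ℕ) → c 0 ≡ 2 → (∀ u → 1 ≤ u → u ≤ suc k → c u ≡ 1) →
  Follows (λ u → c u + sowCount 0 (stair k) (suc k + u) + u) 0 (stair (suc k))
stair-step k c c₀≡2 cᵤ≡1 = interior , singleton-run v (suc k) _ last , _
  where
  v : ℕ → ℕ
  v u = c u + sowCount 0 (stair k) (suc k + u) + u
  interior : ∀ i → i < suc k → v i ≡ suc (suc (suc k))
  interior zero    _ = heads≡ c₀≡2 (segment-all 1 (solve (k ∷ [])) ⟨+⟩ segment-all k (solve (k ∷ [])) ⟨+⟩ refl)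
                         (solve (k ∷ []))
  interior (suc w) (s≤s w<k) with e , k≡ ← m≤n⇒∃[o]m+o≡n w<k rewrite sym k≡ =
    heads≡ (cᵤ≡1 (suc w) (s≤s z≤n) (s≤s (≤-trans (n≤1+n w) (m≤m+n (suc w) e))))
           (segment-part w (e + 1) (solve (w ∷ e ∷ [])) (solve (w ∷ e ∷ [])) ⟨+⟩ segment-all e (solve (w ∷ e ∷ [])) ⟨+⟩ refl)
           (solve (w ∷ e ∷ []))
  last : v (suc k) ≡ suc (suc k)
  last = heads≡ (cᵤ≡1 (suc k) (s≤s z≤n) ≤-refl)
           (segment-none 0 (solve (k ∷ [])) ⟨+⟩ segment-none 0 (solve (k ∷ [])) ⟨+⟩ refl) (solve (k ∷ []))

stair-expired : ∀ k x → sowCount 0 (stair k) (suc k + (suc (suc k) + x)) ≡ 0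
stair-expired k x = segment-none (x + 1) (solve (k ∷ x ∷ [])) ⟨+⟩ segment-none (x + 1) (solve (k ∷ x ∷ [])) ⟨+⟩ refl

tent : ℕ → ℕ → ℕ → List Run
tent h a p = run a (suc h) ∷ run a (suc (suc h)) ∷ run 1 (suc (suc (suc h)))
           ∷ run p (suc (suc h)) ∷ run p (suc h) ∷ run 1 h ∷ []

tent-span : ∀ h a p → span (tent h a p) ≡ suc (suc ((a + p) + (a + p)))
tent-span h a p = lemma a p
  where
  lemma : ∀ a p → a + (a + (1 + (p + (p + 1)))) ≡ suc (suc ((a + p) + (a + p)))
  lemma = solve-∀

stair-to-tent : ∀ q (c : ℕ → ℕ) → c 0 ≡ 3 → (∀ i → i < q → c (suc i) ≡ 1) → (∀ u → suc q ≤ u → c u ≡ 0) →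
  Follows (λ u → c u + sowCount 0 (stair (q + q)) (suc (q + q) + u) + u) 0 (tent (suc (q + q)) 0 q)
stair-to-tent q c c₀≡3 c₊≡1 c≡0 =
  (λ _ ()) , (λ _ ()) , singleton-run v 0 _ peak , rising , falling , singleton-run v (suc q + q) _ last , _
  where
  v : ℕ → ℕ
  v u = c u + sowCount 0 (stair (q + q)) (suc (q + q) + u) + u
  peak : v 0 ≡ suc (suc (suc (suc (q + q))))
  peak = heads≡ c₀≡3 (segment-all 1 (solve (q ∷ [])) ⟨+⟩ segment-all (q + q) (solve (q ∷ [])) ⟨+⟩ refl) (solve (q ∷ []))
  rising : ∀ i → i < q → v (1 + i) ≡ suc (suc (suc (q + q)))
  rising i i<q with e , q≡ ← m≤n⇒∃[o]m+o≡n i<q rewrite sym q≡ =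
    heads≡ (c₊≡1 i (m≤m+n (suc i) e))
           (segment-part i (i + e + e + 2) (solve (i ∷ e ∷ [])) (solve (i ∷ e ∷ [])) ⟨+⟩ segment-all (i + e + e + 1) (solve (i ∷ e ∷ [])) ⟨+⟩ refl)
           (solve (i ∷ e ∷ []))
  falling : ∀ i → i < q → v (suc q + i) ≡ suc (suc (q + q))
  falling i i<q with e , q≡ ← m≤n⇒∃[o]m+o≡n i<q rewrite sym q≡ =
    heads≡ (c≡0 (suc (suc i + e) + i) (s≤s (m≤m+n _ i)))
           (segment-part (e + i + i + 1) (e + 1) (solve (i ∷ e ∷ [])) (solve (i ∷ e ∷ [])) ⟨+⟩ segment-all e (solve (i ∷ e ∷ [])) ⟨+⟩ refl)
           (solve (i ∷ e ∷ []))
  last : v (suc q + q) ≡ suc (q + q)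
  last = heads≡ (c≡0 (suc q + q) (s≤s (m≤m+n q q)))
           (segment-none 0 (solve (q ∷ [])) ⟨+⟩ segment-none 0 (solve (q ∷ [])) ⟨+⟩ refl) (solve (q ∷ []))

tent-step : ∀ h a p (c : ℕ → ℕ) → (∀ u → c u ≡ 0) → h ≡ suc ((a + suc p) + (a + suc p)) →
  Follows (λ u → c u + sowCount 0 (tent h a (suc p)) (suc h + u) + u) 0 (tent h (suc a) p)
tent-step h a p c c≡0 h≡ =
  lowerLeft , upperLeft , singleton-run v (suc a + suc a) _ peak , upperRight , lowerRight ,
  singleton-run v ((((suc a + suc a) + 1) + p) + p) _ last , _
  where
  v : ℕ → ℕ
  v u = c u + sowCount 0 (tent h a (suc p)) (suc h + u) + u
  lowerLeft : ∀ i → i < suc a → v i ≡ suc h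
  lowerLeft i (s≤s i≤a) rewrite h≡ with e , a≡ ← m≤n⇒∃[o]m+o≡n i≤a rewrite sym a≡ =
    heads≡ (c≡0 i)
      (segment-part i e (solve (i ∷ e ∷ p ∷ [])) (solve (i ∷ e ∷ p ∷ []))
       ⟨+⟩ segment-all (e + 1) (solve (i ∷ e ∷ p ∷ []))
       ⟨+⟩ segment-all (e + e + i + 2) (solve (i ∷ e ∷ p ∷ []))
       ⟨+⟩ segment-all (e + e + i + 2) (solve (i ∷ e ∷ p ∷ []))
       ⟨+⟩ segment-all (e + e + i + p + 2) (solve (i ∷ e ∷ p ∷ []))
       ⟨+⟩ segment-all (e + e + i + p + p + 2) (solve (i ∷ e ∷ p ∷ [])) ⟨+⟩ refl)
      (solve (i ∷ e ∷ p ∷ []))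
  upperLeft : ∀ i → i < suc a → v (suc a + i) ≡ suc (suc h)
  upperLeft i (s≤s i≤a) rewrite h≡ with e , a≡ ← m≤n⇒∃[o]m+o≡n i≤a rewrite sym a≡ =
    heads≡ (c≡0 _)
      (segment-none (i + 1) (solve (i ∷ e ∷ p ∷ []))
       ⟨+⟩ segment-part i e (solve (i ∷ e ∷ p ∷ [])) (solve (i ∷ e ∷ p ∷ []))
       ⟨+⟩ segment-all (e + 1) (solve (i ∷ e ∷ p ∷ []))
       ⟨+⟩ segment-all (e + 1) (solve (i ∷ e ∷ p ∷ []))
       ⟨+⟩ segment-all (e + p + 1) (solve (i ∷ e ∷ p ∷ []))
       ⟨+⟩ segment-all (e + p + p + 1) (solve (i ∷ e ∷ p ∷ [])) ⟨+⟩ refl)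
      (solve (i ∷ e ∷ p ∷ []))
  peak : v (suc a + suc a) ≡ suc (suc (suc h))
  peak rewrite h≡ = heads≡ (c≡0 _)
      (segment-none (a + 2) (solve (a ∷ p ∷ []))
       ⟨+⟩ segment-none 1 (solve (a ∷ p ∷ []))
       ⟨+⟩ segment-all 0 (solve (a ∷ p ∷ []))
       ⟨+⟩ segment-all 0 (solve (a ∷ p ∷ []))
       ⟨+⟩ segment-all p (solve (a ∷ p ∷ []))
       ⟨+⟩ segment-all (p + p) (solve (a ∷ p ∷ [])) ⟨+⟩ refl)
      (solve (a ∷ p ∷ []))
  upperRight : ∀ i → i < p → v (((suc a + suc a) + 1) + i) ≡ suc (suc h)
  upperRight i i<p rewrite h≡ with e , p≡ ← m≤n⇒∃[o]m+o≡n i<p rewrite sym p≡ =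
    heads≡ (c≡0 _)
      (segment-none (a + i + 3) (solve (a ∷ i ∷ e ∷ []))
       ⟨+⟩ segment-none (i + 2) (solve (a ∷ i ∷ e ∷ []))
       ⟨+⟩ segment-none i (solve (a ∷ i ∷ e ∷ []))
       ⟨+⟩ segment-part (i + 1) (e + 1) (solve (a ∷ i ∷ e ∷ [])) (solve (a ∷ i ∷ e ∷ []))
       ⟨+⟩ segment-all e (solve (a ∷ i ∷ e ∷ []))
       ⟨+⟩ segment-all (e + e + i + 1) (solve (a ∷ i ∷ e ∷ [])) ⟨+⟩ refl)
      (solve (a ∷ i ∷ e ∷ []))
  lowerRight : ∀ i → i < p → v ((((suc a + suc a) + 1) + p) + i) ≡ suc h
  lowerRight i i<p rewrite h≡ with e , p≡ ← m≤n⇒∃[o]m+o≡n i<p rewrite sym p≡ =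
    heads≡ (c≡0 _)
      (segment-none (a + e + i + i + 4) (solve (a ∷ i ∷ e ∷ []))
       ⟨+⟩ segment-none (e + i + i + 3) (solve (a ∷ i ∷ e ∷ []))
       ⟨+⟩ segment-none (e + i + i + 1) (solve (a ∷ i ∷ e ∷ []))
       ⟨+⟩ segment-none i (solve (a ∷ i ∷ e ∷ []))
       ⟨+⟩ segment-part (i + 1) (e + 1) (solve (a ∷ i ∷ e ∷ [])) (solve (a ∷ i ∷ e ∷ []))
       ⟨+⟩ segment-all e (solve (a ∷ i ∷ e ∷ [])) ⟨+⟩ refl)
      (solve (a ∷ i ∷ e ∷ []))
  last : v ((((suc a + suc a) + 1) + p) + p) ≡ h
  last rewrite h≡ = heads≡ (c≡0 _)
      (segment-none (a + p + p + 3) (solve (a ∷ p ∷ []))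
       ⟨+⟩ segment-none (p + p + 2) (solve (a ∷ p ∷ []))
       ⟨+⟩ segment-none (p + p) (solve (a ∷ p ∷ []))
       ⟨+⟩ segment-none p (solve (a ∷ p ∷ []))
       ⟨+⟩ segment-none 0 (solve (a ∷ p ∷ []))
       ⟨+⟩ segment-none 0 (solve (a ∷ p ∷ [])) ⟨+⟩ refl)
      (solve (a ∷ p ∷ []))

tent-expired : ∀ h a p x → h ≡ suc ((a + suc p) + (a + suc p)) → sowCount 0 (tent h a (suc p)) (suc h + (suc h + x)) ≡ 0
tent-expired h a p x h≡ rewrite h≡ =
  segment-none (a + p + p + x + 4) (solve (a ∷ p ∷ x ∷ []))
  ⟨+⟩ segment-none (p + p + x + 3) (solve (a ∷ p ∷ x ∷ []))
  ⟨+⟩ segment-none (p + p + x + 1) (solve (a ∷ p ∷ x ∷ []))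
  ⟨+⟩ segment-none (p + x + 1) (solve (a ∷ p ∷ x ∷ []))
  ⟨+⟩ segment-none (x + 1) (solve (a ∷ p ∷ x ∷ []))
  ⟨+⟩ segment-none (x + 1) (solve (a ∷ p ∷ x ∷ [])) ⟨+⟩ refl

tent-final-rising : ∀ q i → i ≤ q → sowCount 0 (tent (suc (q + q)) q 0) (suc (suc (q + q)) + i) ≡ M (suc (suc (q + q))) i
tent-final-rising q i i≤q with e , refl ← m≤n⇒∃[o]m+o≡n i≤q = trans
      (segment-part i e (solve (i ∷ e ∷ [])) (solve (i ∷ e ∷ []))
       ⟨+⟩ segment-all (e + 1) (solve (i ∷ e ∷ []))
       ⟨+⟩ segment-all (e + e + i + 2) (solve (i ∷ e ∷ []))
       ⟨+⟩ segment-all (e + e + i + 2) (solve (i ∷ e ∷ []))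
       ⟨+⟩ segment-all (e + e + i + 1) (solve (i ∷ e ∷ []))
       ⟨+⟩ segment-all (e + e + i) (solve (i ∷ e ∷ [])) ⟨+⟩ refl)
      (sym (∸-≡ (suc (suc (q + q))) i _ (solve (i ∷ e ∷ []))))

tent-final : ∀ q i → let L = suc (suc (q + q)) in
  sowCount 0 (tent (suc (q + q)) q 0) (L + i) ≡ M L i ⊎ sowCount 0 (tent (suc (q + q)) q 0) (L + i) ≡ M (suc L) i
tent-final q i with i ≤? q
... | yes i≤q = inj₁ (tent-final-rising q i i≤q)
... | no i≰q with w , refl ← m≤n⇒∃[o]m+o≡n (≰⇒> i≰q) with w <? q
...   | yes w<q with e , refl ← m≤n⇒∃[o]m+o≡n w<q = inj₂ (trans
      (segment-none (w + 1) (solve (w ∷ e ∷ []))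
       ⟨+⟩ segment-part w (e + 1) (solve (w ∷ e ∷ [])) (solve (w ∷ e ∷ []))
       ⟨+⟩ segment-all (e + 2) (solve (w ∷ e ∷ []))
       ⟨+⟩ segment-all (e + 2) (solve (w ∷ e ∷ []))
       ⟨+⟩ segment-all (e + 1) (solve (w ∷ e ∷ []))
       ⟨+⟩ segment-all e (solve (w ∷ e ∷ [])) ⟨+⟩ refl)
      (sym (∸-≡ (suc (suc (suc (q + q)))) (suc q + w) _ (solve (w ∷ e ∷ [])))))
...   | no w≮q with m≤n⇒∃[o]m+o≡n (≮⇒≥ w≮q)
...     | zero , refl = inj₁ (trans
      (segment-none (q + 1) (solve (q ∷ []))
       ⟨+⟩ segment-none 0 (solve (q ∷ []))
       ⟨+⟩ segment-all 1 (solve (q ∷ []))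
       ⟨+⟩ segment-all 1 (solve (q ∷ []))
       ⟨+⟩ segment-all 0 (solve (q ∷ []))
       ⟨+⟩ segment-none 0 (solve (q ∷ [])) ⟨+⟩ refl)
      (sym (∸-≡ (suc (suc (q + q))) (suc q + (q + 0)) _ (solve (q ∷ [])))))
...     | suc zero , refl = inj₂ (trans
      (segment-none (q + 2) (solve (q ∷ []))
       ⟨+⟩ segment-none 1 (solve (q ∷ []))
       ⟨+⟩ segment-all 0 (solve (q ∷ []))
       ⟨+⟩ segment-all 0 (solve (q ∷ []))
       ⟨+⟩ segment-none 1 (solve (q ∷ []))
       ⟨+⟩ segment-none 1 (solve (q ∷ [])) ⟨+⟩ refl)
      (sym (∸-≡ (suc (suc (suc (q + q)))) (suc q + (q + 1)) _ (solve (q ∷ [])))))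
...     | suc (suc x) , refl = inj₁ (trans
      (segment-none (q + x + 3) (solve (q ∷ x ∷ []))
       ⟨+⟩ segment-none (x + 2) (solve (q ∷ x ∷ []))
       ⟨+⟩ segment-none x (solve (q ∷ x ∷ []))
       ⟨+⟩ segment-none (x + 1) (solve (q ∷ x ∷ []))
       ⟨+⟩ segment-none (x + 2) (solve (q ∷ x ∷ []))
       ⟨+⟩ segment-none (x + 2) (solve (q ∷ x ∷ [])) ⟨+⟩ refl)
      (sym (∸-≡0 (suc (suc (q + q))) (suc q + (q + suc (suc x))) (x + 1) (solve (q ∷ x ∷ [])))))

depth-arithmetic : ∀ N q → N + suc (suc (q + q)) + 2 * suc q * q ≡ 2 + (N + q * suc (suc (q + q)) + (q + q))
depth-arithmetic = solve-∀

-- r = q + 1. N = T(2r-1) is the index of the entry 3 of C; the tent blocks have base height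
-- h = 2r-1 and length L = 2r.
module HeavisideOrbit (q : ℕ) where

  r : ℕ
  r = suc q

  C : Config
  C = heavisideC r

  N h L : ℕ
  N = T (suc (q + q))
  h = suc (q + q)
  L = suc h

  2r≡ : 2 * r ≡ suc (suc (q + q))
  2r≡ = 2*suc q

  top≡N : T (2 * r ∸ 1) ≡ N
  top≡N = cong (T ∘ (_∸ 1)) 2r≡

  C-beyond : ∀ i → N + r ≤ i → C i ≡ 0
  C-beyond i N+r≤i = if-true (<⇒<ᵇ (s≤s (subst (λ n → n + r ≤ i) (sym top≡N) N+r≤i)))

  C-below : ∀ i → i < N + r →
    C i ≡ (if suc i ≡ᵇ T (2 * r ∸ 1) + 1 then 3 else if isTriPlusOne r (suc i) then 2 else 1)
  C-below i i<N+r = if-false λ beyond → <⇒≱ i<N+r (subst (λ n → n + r ≤ i) top≡N (≤-pred (<ᵇ⇒< _ _ beyond)))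

  N<N+r : N < N + r
  N<N+r = m<m+n N z<s

  C-peak : C N ≡ 3
  C-peak = trans (C-below N N<N+r) (if-true (≡⇒≡ᵇ _ _ (trans (+-comm 1 N) (cong (_+ 1) (sym top≡N)))))

  C-other : ∀ i → i < N + r → i ≢ N →
    C i ≡ (if isTriPlusOne r (suc i) then 2 else 1)
  C-other i i<N+r i≢N = trans (C-below i i<N+r) (if-false λ peak →
    i≢N (suc-injective (trans (≡ᵇ⇒≡ _ _ peak) (trans (cong (_+ 1) top≡N) (+-comm N 1)))))

  2r-2≡ : 2 * r ∸ 2 ≡ q + q
  2r-2≡ = cong (_∸ 2) 2r≡

  C-step : ∀ k → k < q + q → C (T (suc k)) ≡ 2
  C-step k k<2q = trans (C-other _ (<-≤-trans Tk<N (m≤m+n N r)) (<⇒≢ Tk<N))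
                        (if-true (isTriPlusOne-true r k (subst (k <_) (sym 2r-2≡) k<2q)))
    where
    Tk<N : T (suc k) < N
    Tk<N = T-mono-< (s≤s k<2q)

  C-flat : ∀ i → i < N + r → i ≢ N → (∀ k → k < q + q → i ≢ T (suc k)) → C i ≡ 1
  C-flat i i<N+r i≢N notTri = trans (C-other i i<N+r i≢N)
    (if-false (isTriPlusOne-false r i λ k k<2r-2 → notTri k (subst (k <_) 2r-2≡ k<2r-2)))

  open Sowing C

  C-origin : C 0 ≡ 1
  C-origin = C-flat 0 (<-≤-trans (T-suc-pos (q + q)) (m≤m+n N r)) (<⇒≢ (T-suc-pos (q + q)))
                    (λ k _ → <⇒≢ (T-suc-pos k))

  C-stair : ∀ k u → 1 ≤ u → u ≤ k → k ≤ q + q → C (T k + u) ≡ 1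
  C-stair k u 1≤u u≤k k≤2q = C-flat _ (<-≤-trans below-N (m≤m+n N r)) (<⇒≢ below-N)
                                      (λ p _ → ≢-sym (T-gap k u (suc p) 1≤u u≤k))
    where
    below-N : T k + u < N
    below-N = <-≤-trans (+-monoʳ-< (T k) (s≤s u≤k)) (T-mono-≤ (s≤s k≤2q))

  C-after-peak : ∀ i → i < q → C (N + suc i) ≡ 1
  C-after-peak i i<q = C-flat _ (+-monoʳ-< N (s≤s i<q)) (m+1+n≢m N) (λ k k<2q → >⇒≢ (tri<N k k<2q))
    where
    tri<N : ∀ k → k < q + q → T (suc k) < N + suc i
    tri<N k k<2q = <-≤-trans (T-mono-< (s≤s k<2q)) (m≤m+n N (suc i))

  C-beyond-peak : ∀ u → r ≤ u → C (N + u) ≡ 0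
  C-beyond-peak u r≤u = C-beyond (N + u) (+-monoʳ-≤ N r≤u)

  stairCarry : ℕ → ℕ → ℕ
  stairCarry zero    x = 0
  stairCarry (suc k) x = sowCount 0 (stair k) (suc k + x)

  stair-follows : ∀ k → k ≤ q + q → Follows (blockHeads (T k) (stairCarry k)) 0 (stair k)
  stair-follows zero    _     = (λ _ ()) , singleton-run _ 0 1 (trans (+-identityʳ _) (trans (+-identityʳ _) C-origin)) , _
  stair-follows (suc k) k<2q =
    stair-step k (λ u → C (T (suc k) + u)) (trans (cong C (+-identityʳ _)) (C-step k k<2q))
               (λ u 1≤u u≤1+k → C-stair (suc k) u 1≤u u≤1+k k<2q)

  stair-block : ∀ k → k ≤ q + q → Carry (T k) (stairCarry k) → Block (T k) (stairCarry k) (stair k) (suc k)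
  stair-block k k≤2q carried = record
    { carried = carried
    ; follows = stair-follows k k≤2q
    ; spans   = +-comm k 1
    ; floor   = k
    ; spanned = ≤-refl
    ; tall    = m≤n+m k 2 , m≤n+m k 1 , _
    }

  stairCarry-expired : ∀ k x → stairCarry k (suc k + x) ≡ 0
  stairCarry-expired zero    x = refl
  stairCarry-expired (suc k) x = stair-expired k x

  stair-carry : ∀ k → k ≤ suc (q + q) → Carry (T k) (stairCarry k)
  stair-carry zero    _          x = refl
  stair-carry (suc k) k<1+2q =
    Carry-cong (T (suc k)) (block-carry (stair-block k (≤-pred k<1+2q) (stair-carry k (≤-trans (n≤1+n k) k<1+2q))))
               (λ x → cong (_+ stairCarry (suc k) x) (stairCarry-expired k x))

  tentStart : ℕ → ℕ
  tentStart zero    = N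
  tentStart (suc m) = tentStart m + L

  tentCarry : ℕ → ℕ → ℕ
  tentCarry zero      = stairCarry (suc (q + q))
  tentCarry (suc m) x = sowCount 0 (tent h m (q ∸ m)) (L + x)

  q∸m≡p : ∀ m p → m + p ≡ q → q ∸ m ≡ p
  q∸m≡p m p m+p≡q = ∸-≡ q m p (sym m+p≡q)

  h≡ : ∀ m p → m + p ≡ q → h ≡ suc ((m + p) + (m + p))
  h≡ m p m+p≡q = cong (λ n → suc (n + n)) (sym m+p≡q)

  N≤tentStart : ∀ m → N ≤ tentStart m
  N≤tentStart zero    = ≤-refl
  N≤tentStart (suc m) = ≤-trans (N≤tentStart m) (m≤m+n _ L)

  C-after-tent : ∀ m u → C (tentStart m + L + u) ≡ 0
  C-after-tent m u = C-beyond _ (≤-trans (+-mono-≤ (N≤tentStart m) (≤-trans (m≤m+n r q) (n≤1+n _)))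
                                          (m≤m+n _ u))

  tent-follows : ∀ m p → m + p ≡ q → Follows (blockHeads (tentStart m) (tentCarry m)) 0 (tent h m p)
  tent-follows zero    p p≡q = subst (Follows _ 0 ∘ tent h 0) (sym p≡q)
    (stair-to-tent q (λ u → C (N + u)) (trans (cong C (+-identityʳ N)) C-peak) C-after-peak C-beyond-peak)
  tent-follows (suc m) p 1+m+p≡q =
    subst (λ p′ → Follows (λ u → C (tentStart m + L + u) + sowCount 0 (tent h m p′) (L + u) + u) 0 (tent h (suc m) p))
          (sym (q∸m≡p m (suc p) m+1+p≡q))
          (tent-step h m p (λ u → C (tentStart m + L + u)) (C-after-tent m) (h≡ m (suc p) m+1+p≡q))
    where
    m+1+p≡q : m + suc p ≡ q
    m+1+p≡q = trans (+-suc m p) 1+m+p≡q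

  tent-block : ∀ m p → m + p ≡ q → Carry (tentStart m) (tentCarry m) → Block (tentStart m) (tentCarry m) (tent h m p) L
  tent-block m p m+p≡q carried = record
    { carried = carried
    ; follows = tent-follows m p m+p≡q
    ; spans   = trans (tent-span h m p) (cong (λ n → suc (suc (n + n))) m+p≡q)
    ; floor   = h
    ; spanned = ≤-refl
    ; tall    = m≤n+m h 1 , m≤n+m h 2 , m≤n+m h 3 , m≤n+m h 2 , m≤n+m h 1 , ≤-refl , _
    }

  tentCarry-expired : ∀ m p → m + p ≡ q → ∀ x → tentCarry m (L + x) ≡ 0
  tentCarry-expired zero    p _         x = stair-expired (q + q) x
  tentCarry-expired (suc m) p 1+m+p≡q x =
    trans (cong (λ p′ → sowCount 0 (tent h m p′) (L + (L + x))) (q∸m≡p m (suc p) m+1+p≡q))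
          (tent-expired h m p x (h≡ m (suc p) m+1+p≡q))
    where
    m+1+p≡q : m + suc p ≡ q
    m+1+p≡q = trans (+-suc m p) 1+m+p≡q

  tent-carry : ∀ m p → m + p ≡ q → Carry (tentStart m) (tentCarry m)
  tent-carry zero    p _         = stair-carry (suc (q + q)) ≤-refl
  tent-carry (suc m) p 1+m+p≡q =
    Carry-cong (tentStart (suc m)) (block-carry (tent-block m (suc p) m+1+p≡q (tent-carry m (suc p) m+1+p≡q)))
               (λ x → cong₂ _+_ (tentCarry-expired m (suc p) m+1+p≡q x)
                                (cong (λ p′ → sowCount 0 (tent h m p′) (L + x)) (sym (q∸m≡p m (suc p) m+1+p≡q))))
    where
    m+1+p≡q : m + suc p ≡ q
    m+1+p≡q = trans (+-suc m p) 1+m+p≡q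

  lastBlock : Block (tentStart q) (tentCarry q) (tent h q 0) L
  lastBlock = tent-block q 0 (+-identityʳ q) (tent-carry q 0 (+-identityʳ q))

  final-config : ∀ i → Φ^ (tentStart q + L) C i ≡ sowCount 0 (tent h q 0) (L + i)
  final-config i = begin
    Φ^ (tentStart q + L) C i
      ≡⟨ Φ^-count (tentStart q + L) i ⟩
    C (tentStart q + L + i) + count≥ reach (tentStart q + L) (tentStart q + L + i)
      ≡⟨ cong₂ _+_ (C-after-tent q i) (block-carry lastBlock i) ⟩
    0 + (tentCarry q (L + i) + sowCount 0 (tent h q 0) (L + i))
      ≡⟨ cong (_+ sowCount 0 (tent h q 0) (L + i)) (tentCarry-expired q 0 (+-identityʳ q) i) ⟩
    sowCount 0 (tent h q 0) (L + i)
      ∎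
    where open ≡-Reasoning

  final-augmented : IsAugMarching (Φ^ (tentStart q + L) C)
  final-augmented = sandwiched⇒augmented
    (between-marching⇒sandwiched λ i → ⊎-map (trans (final-config i)) (trans (final-config i)) (tent-final q i))
    λ λ₀≡1+L → 1+n≢n (trans (sym λ₀≡1+L) (trans (final-config 0) (tent-final-rising q 0 z≤n)))

  peakTime : ℕ
  peakTime = tentStart q + (q + q)

  head-drop : 2 + head (suc peakTime) ≤ head peakTime
  head-drop with _ , _ , peak , _ , _ , last , _ ← Block.follows lastBlock =
    subst₂ (λ a b → 2 + a ≤ b) (sym head-last) (sym head-peak) (n≤1+n (suc (suc h)))
    where
    v : ℕ → ℕ
    v = blockHeads (tentStart q) (tentCarry q)
    head-peak : head peakTime ≡ suc (suc (suc h))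
    head-peak = trans (block-heads lastBlock (q + q) (m<n⇒m<1+n (n<1+n (q + q)))) (singleton-run⁻ v (q + q) _ peak)
    head-last : head (suc peakTime) ≡ h
    head-last = begin
      head (suc peakTime)            ≡⟨ cong head (+-suc (tentStart q) (q + q)) ⟨
      head (tentStart q + suc (q + q)) ≡⟨ block-heads lastBlock (suc (q + q)) (n<1+n _) ⟩
      v (suc (q + q))                ≡⟨ cong v (trans (+-comm 1 (q + q)) (sym (trans (+-identityʳ _) (+-identityʳ _)))) ⟩
      v ((((q + q) + 1) + 0) + 0)    ≡⟨ singleton-run⁻ v _ _ last ⟩
      h                              ∎
      where open ≡-Reasoning

  depth : DepthIs C (2 + peakTime)
  depth = depth-after-drop C peakTime head-drop (subst (λ t → IsAugMarching (Φ^ t C)) end≡ final-augmented)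
    where
    end≡ : tentStart q + L ≡ 2 + peakTime
    end≡ = trans (+-suc (tentStart q) h) (cong suc (+-suc (tentStart q) (q + q)))

  tentStart≡ : ∀ m → tentStart m ≡ N + m * L
  tentStart≡ zero    = sym (+-identityʳ N)
  tentStart≡ (suc m) = trans (cong (_+ L) (tentStart≡ m)) (trans (+-assoc N (m * L) L) (cong (N +_) (+-comm (m * L) L)))

  depth-value : T (2 * r) + 2 * r * (r ∸ 1) ≡ 2 + peakTime
  depth-value = begin
    T (2 * r) + 2 * r * q          ≡⟨ cong (λ n → T n + 2 * r * q) 2r≡ ⟩
    N + L + 2 * r * q              ≡⟨ depth-arithmetic N q ⟩
    2 + (N + q * L + (q + q))      ≡⟨ cong (λ t → 2 + (t + (q + q))) (tentStart≡ q) ⟨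
    2 + peakTime                   ∎
    where open ≡-Reasoning

mainTheorem11 : (r : ℕ) → 1 ≤ r →
    DepthIs (heavisideC r) (T (2 * r) + 2 * r * (r ∸ 1))
mainTheorem11 (suc q) _ = subst (DepthIs (heavisideC (suc q))) (sym depth-value) depth
  where open HeavisideOrbit q
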